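{- For all $e\in\mathsf{Exp}$ and $\alpha\in\mathsf{At}$, $E(e)_\alpha=\partial(e)_\alpha(\checkmark)$.
   Context: Fix a Conway semiring $(\mathbb S,+,\cdot,0,1)$ (with $^*$ satisfying $(a+b)^*=a^*(ba^*)^*$, $(ab)^*=1+a(ba)^*b$; also assumed positive and refinement). Finite set $T$ of primitive tests; sets $\mathsf{Act}$, $\mathsf{Out}$. Tests $b::=\mathbf 0\mid\mathbf 1\mid t\in T\mid\bar b\mid b+c\mid bc$; $\mathsf{At}$ atoms of the free Boolean algebra on $T$; $\le_{BA}$ entailment. Expressions $e,f::=p\in\mathsf{Act}\mid b\mid e+_bf\mid e;f\mid e^{(b)}\mid v\in\mathsf{Out}\mid e\oplus_{r,s}f$. $E:\mathsf{Exp}\to\mathsf{At}\to\mathbb S$: $E(p)_\alpha=E(v)_\alpha=0$; $E(b)_\alpha=1$ if $\alpha\le_{BA}b$, $0$ if $\alpha\le_{BA}\bar b$; $E(e\oplus_{r,s}f)_\alpha=rE(e)_\alpha+sE(f)_\alpha$; $E(e+_bf)_\alpha=E(e)_\alpha$ if $\alpha\le_{BA}b$ else $E(f)_\alpha$; $E(e;f)_\alpha=E(e)_\alpha E(f)_\alpha$; $E(e^{(b)})_\alpha=E(\bar b)_\alpha$. $\partial:\mathsf{Exp}\to\mathcal M_\omega(2+\mathsf{Out}+\mathsf{Act}\times\mathsf{Exp})^{\mathsf{At}}$ ($\mathcal M_\omega$ = finitely supported $\mathbb S$-valued maps, $2=\{\checkmark,\times\}$): $\partial(b)_\alpha=\delta_\checkmark$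 if $\alpha\le_{BA}b$ else $\delta_\times$; $\partial(v)_\alpha=\delta_v$; $\partial(p)_\alpha=\delta_{(p,\mathbf 1)}$; $\partial(e+_bf)_\alpha=\partial(e)_\alpha$ if $\alpha\le_{BA}b$ else $\partial(f)_\alpha$; $\partial(e\oplus_{r,s}f)_\alpha=r\partial(e)_\alpha+s\partial(f)_\alpha$; $\partial(e;f)_\alpha=\sum_x\partial(e)_\alpha(x)c_{\alpha,f}(x)$ with $c_{\alpha,f}(\checkmark)=\partial(f)_\alpha$, $c_{\alpha,f}(o)=\delta_o$ ($o\in\{\times\}\cup\mathsf{Out}$), $c_{\alpha,f}(p,e')=\delta_{(p,e';f)}$; $\partial(e^{(b)})_\alpha=\delta_\checkmark$ if $\alpha\le_{BA}\bar b$, and for $\alpha\le_{BA}b$, $\partial(e^{(b)})_\alpha=\partial(e)_\alpha(\checkmark)^*\big(\sum_{o\in\{\times\}\cup\mathsf{Out}}\partial(e)_\alpha(o)\delta_o+\sum_{(p,e')}\partial(e)_\alpha(p,e')\delta_{(p,e';e^{(b)})}\big)$. -}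

module Defs where

open import Level using (Level; _⊔_; suc)
open import Algebra.Bundles using (Semiring)
open import Data.Nat using (ℕ)
open import Data.Fin using (Fin)
open import Data.Bool using (Bool; true; false; not; _∧_; _∨_)
open import Data.List using (List; []; _∷_; map; concatMap; _++_)
open import Data.Product using (_×_; _,_; ∃-syntax)
open import Data.Sum using (_⊎_)

record ConwaySemiring (c ℓ : Level) : Set (suc (c ⊔ ℓ)) where
  field
    semiring : Semiring c ℓ
  open Semiring semiring public
  field
    _⋆ : Carrier → Carrier
    sum-star     : ∀ a b → ((a + b) ⋆) ≈ ((a ⋆) * ((b * (a ⋆)) ⋆))
    product-star : ∀ a b → ((a * b) ⋆) ≈ (1# + (a * (((b * a) ⋆) * b)))
    zero-sum-free : ∀ a b → (a + b) ≈ 0# → a ≈ 0#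
    no-zero-div   : ∀ a b → (a * b) ≈ 0# → (a ≈ 0#) ⊎ (b ≈ 0#)
    refinement : ∀ a₁ a₂ b₁ b₂ → (a₁ + a₂) ≈ (b₁ + b₂) →
      ∃[ c₁₁ ] ∃[ c₁₂ ] ∃[ c₂₁ ] ∃[ c₂₂ ]
        ((a₁ ≈ (c₁₁ + c₁₂)) × (a₂ ≈ (c₂₁ + c₂₂)) ×
         (b₁ ≈ (c₁₁ + c₂₁)) × (b₂ ≈ (c₁₂ + c₂₂)))

data Test (n : ℕ) : Set where
  𝟘 𝟙 : Test n
  prim : Fin n → Test n
  neg  : Test n → Test n
  _∨ᵗ_ _∧ᵗ_ : Test n → Test n → Test n

-- Atoms of the free Boolean algebra on Fin n, identified with valuations.
At : ℕ → Set
At n = Fin n → Bool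

-- α ≤_BA b  iff  b evaluates to true at α
⟦_⟧ᵗ : ∀ {n} → Test n → At n → Bool
⟦ 𝟘 ⟧ᵗ α = false
⟦ 𝟙 ⟧ᵗ α = true
⟦ prim t ⟧ᵗ α = α t
⟦ neg b ⟧ᵗ α = not (⟦ b ⟧ᵗ α)
⟦ b ∨ᵗ c ⟧ᵗ α = ⟦ b ⟧ᵗ α ∨ ⟦ c ⟧ᵗ α
⟦ b ∧ᵗ c ⟧ᵗ α = ⟦ b ⟧ᵗ α ∧ ⟦ c ⟧ᵗ α

module Semantics {c ℓ : Level} (𝕊 : ConwaySemiring c ℓ)
                 (n : ℕ) (Act Out : Set) where
  open ConwaySemiring 𝕊

  data Exp : Set c where
    act   : Act → Exp
    test  : Test n → Exp
    _+[_]_ : Exp → Test n → Exp → Exp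
    _⨾_   : Exp → Exp → Exp
    loop  : Exp → Test n → Exp
    out   : Out → Exp
    _⊕[_,_]_ : Exp → Carrier → Carrier → Exp → Exp

  if_then_else_ : ∀ {a} {A : Set a} → Bool → A → A → A
  if true  then x else y = x
  if false then x else y = y

  E : Exp → At n → Carrier
  E (act p) α = 0#
  E (out v) α = 0#
  E (test b) α = if ⟦ b ⟧ᵗ α then 1# else 0#
  E (e ⊕[ r , s ] f) α = (r * E e α) + (s * E f α)
  E (e +[ b ] f) α = if ⟦ b ⟧ᵗ α then E e α else E f α
  E (e ⨾ f) α = E e α * E f α
  E (loop e b) α = E (test (neg b)) α

  data Label : Set c where
    ✓ ✗ : Label
    outL : Out → Label
    step : Act → Exp → Label

  -- finitely supported S-valued maps on Label, as finite formal sums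
  M : Set c
  M = List (Carrier × Label)

  δ : Label → M
  δ x = (1# , x) ∷ []

  _·ᴹ_ : Carrier → M → M
  r ·ᴹ m = map (λ { (w , x) → (r * w , x) }) m

  _+ᴹ_ : M → M → M
  _+ᴹ_ = _++_

  bind : M → (Label → M) → M
  bind m k = concatMap (λ { (w , x) → w ·ᴹ k x }) m

  at✓ : M → Carrier
  at✓ [] = 0#
  at✓ ((w , ✓) ∷ m) = w + at✓ m
  at✓ ((w , ✗) ∷ m) = at✓ m
  at✓ ((w , outL _) ∷ m) = at✓ m
  at✓ ((w , step _ _) ∷ m) = at✓ m

  ∂ : Exp → At n → M
  ∂ (test b) α = if ⟦ b ⟧ᵗ α then δ ✓ else δ ✗
  ∂ (out v) α = δ (outL v)
  ∂ (act p) α = δ (step p (test 𝟙))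
  ∂ (e +[ b ] f) α = if ⟦ b ⟧ᵗ α then ∂ e α else ∂ f α
  ∂ (e ⊕[ r , s ] f) α = (r ·ᴹ ∂ e α) +ᴹ (s ·ᴹ ∂ f α)
  ∂ (e ⨾ f) α = bind (∂ e α) cont
    where
      cont : Label → M
      cont ✓ = ∂ f α
      cont ✗ = δ ✗
      cont (outL o) = δ (outL o)
      cont (step p e') = δ (step p (e' ⨾ f))
  ∂ (loop e b) α =
    if ⟦ b ⟧ᵗ α
    then ((at✓ (∂ e α)) ⋆) ·ᴹ bind (∂ e α) cont
    else δ ✓
    where
      cont : Label → M
      cont ✓ = []
      cont ✗ = δ ✗
      cont (outL o) = δ (outL o)
      cont (step p e') = δ (step p (e' ⨾ loop e b))

-- Reading off the ✓-weight of a formal sum is additive and homogeneous, and it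
-- turns `bind` into multiplication as long as the continuation produces ✓ only
-- when resumed from ✓. Hence both sides obey the same recursion on e. For a loop
-- at an atom satisfying b the continuation sends ✓ to the empty sum, so the
-- ✓-weight is (…)⋆ · 0 = 0, matching E (e^(b)) α = 0.
module Submission where

open import Defs
open import Level using (Level; _⊔_)
open import Data.Nat using (ℕ)
open import Data.Bool using (true; false)
open import Data.Product using (_×_; _,_)
open import Data.List using ([]; _∷_; _++_)
import Relation.Binary.Reasoning.Setoid as SetoidReasoning

module ✓-Weight {c ℓ : Level} (𝕊 : ConwaySemiring c ℓ) (n : ℕ) (Act Out : Set) where
  open Semantics 𝕊 n Act Out
  open ConwaySemiring 𝕊
  open SetoidReasoning setoid

  at✓-++ : ∀ m m′ → at✓ (m ++ m′) ≈ at✓ m + at✓ m′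
  at✓-++ []              m′ = sym (+-identityˡ _)
  at✓-++ ((w , ✓) ∷ m)   m′ = trans (+-cong refl (at✓-++ m m′)) (sym (+-assoc _ _ _))
  at✓-++ ((_ , ✗) ∷ m)   m′ = at✓-++ m m′
  at✓-++ ((_ , outL _) ∷ m)   m′ = at✓-++ m m′
  at✓-++ ((_ , step _ _) ∷ m) m′ = at✓-++ m m′

  at✓-·ᴹ : ∀ r m → at✓ (r ·ᴹ m) ≈ r * at✓ m
  at✓-·ᴹ r []              = sym (zeroʳ r)
  at✓-·ᴹ r ((w , ✓) ∷ m)   = trans (+-cong refl (at✓-·ᴹ r m)) (sym (distribˡ r w _))
  at✓-·ᴹ r ((_ , ✗) ∷ m)   = at✓-·ᴹ r m
  at✓-·ᴹ r ((_ , outL _) ∷ m)   = at✓-·ᴹ r m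
  at✓-·ᴹ r ((_ , step _ _) ∷ m) = at✓-·ᴹ r m

  at✓-δ✓ : at✓ (δ ✓) ≈ 1#
  at✓-δ✓ = +-identityʳ 1#

  ✓-Only-From-✓ : (Label → M) → Set (c ⊔ ℓ)
  ✓-Only-From-✓ k =
    at✓ (k ✗) ≈ 0# × (∀ o → at✓ (k (outL o)) ≈ 0#) × (∀ p e → at✓ (k (step p e)) ≈ 0#)

  at✓-bind : ∀ m k → ✓-Only-From-✓ k → at✓ (bind m k) ≈ at✓ m * at✓ (k ✓)
  at✓-bind [] k _ = sym (zeroˡ _)
  at✓-bind ((w , x) ∷ m) k k✓@(k✗ , kout , kstep) = begin
      at✓ ((w ·ᴹ k x) ++ bind m k)
    ≈⟨ at✓-++ (w ·ᴹ k x) (bind m k) ⟩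
      at✓ (w ·ᴹ k x) + at✓ (bind m k)
    ≈⟨ +-cong (at✓-·ᴹ w (k x)) (at✓-bind m k k✓) ⟩
      w * at✓ (k x) + at✓ m * K
    ≈⟨ head x ⟩
      at✓ ((w , x) ∷ m) * K ∎
    where
      K = at✓ (k ✓)

      vanishing : ∀ y → at✓ (k y) ≈ 0# → w * at✓ (k y) + at✓ m * K ≈ at✓ m * K
      vanishing y ky≈0 = trans (+-cong (trans (*-cong refl ky≈0) (zeroʳ w)) refl) (+-identityˡ _)

      head : ∀ y → w * at✓ (k y) + at✓ m * K ≈ at✓ ((w , y) ∷ m) * K
      head ✓          = sym (distribʳ K w (at✓ m))
      head ✗          = vanishing ✗ k✗
      head (outL o)   = vanishing (outL o) (kout o)
      head (step p e) = vanishing (step p e) (kstep p e)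

  E≈at✓∂ : ∀ (e : Exp) (α : At n) → E e α ≈ at✓ (∂ e α)
  E≈at✓∂ (act p) α = refl
  E≈at✓∂ (out v) α = refl
  E≈at✓∂ (test b) α with ⟦ b ⟧ᵗ α
  ... | true  = sym at✓-δ✓
  ... | false = refl
  E≈at✓∂ (e +[ b ] f) α with ⟦ b ⟧ᵗ α
  ... | true  = E≈at✓∂ e α
  ... | false = E≈at✓∂ f α
  E≈at✓∂ (e ⊕[ r , s ] f) α = begin
      r * E e α + s * E f α
    ≈⟨ +-cong (*-cong refl (E≈at✓∂ e α)) (*-cong refl (E≈at✓∂ f α)) ⟩
      r * at✓ (∂ e α) + s * at✓ (∂ f α)
    ≈⟨ sym (+-cong (at✓-·ᴹ r (∂ e α)) (at✓-·ᴹ s (∂ f α))) ⟩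
      at✓ (r ·ᴹ ∂ e α) + at✓ (s ·ᴹ ∂ f α)
    ≈⟨ sym (at✓-++ (r ·ᴹ ∂ e α) (s ·ᴹ ∂ f α)) ⟩
      at✓ (∂ (e ⊕[ r , s ] f) α) ∎
  E≈at✓∂ (e ⨾ f) α =
    trans (*-cong (E≈at✓∂ e α) (E≈at✓∂ f α))
          (sym (at✓-bind (∂ e α) _ (refl , (λ _ → refl) , λ _ _ → refl)))
  E≈at✓∂ (loop e b) α with ⟦ b ⟧ᵗ α
  ... | false = sym at✓-δ✓
  ... | true  = sym (begin
      at✓ ((at✓ (∂ e α) ⋆) ·ᴹ bind (∂ e α) _)
    ≈⟨ at✓-·ᴹ _ (bind (∂ e α) _) ⟩
      (at✓ (∂ e α) ⋆) * at✓ (bind (∂ e α) _)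
    ≈⟨ *-cong refl (at✓-bind (∂ e α) _ (refl , (λ _ → refl) , λ _ _ → refl)) ⟩
      (at✓ (∂ e α) ⋆) * (at✓ (∂ e α) * 0#)
    ≈⟨ *-cong refl (zeroʳ _) ⟩
      (at✓ (∂ e α) ⋆) * 0#
    ≈⟨ zeroʳ _ ⟩
      0# ∎)

mainTheorem7 : ∀ {c ℓ : Level} (𝕊 : ConwaySemiring c ℓ) (n : ℕ) (Act Out : Set) →
    let open Semantics 𝕊 n Act Out
        open ConwaySemiring 𝕊
    in ∀ (e : Exp) (α : At n) → E e α ≈ at✓ (∂ e α)
mainTheorem7 𝕊 n Act Out = ✓-Weight.E≈at✓∂ 𝕊 n Act Out
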